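{- For all implicative-disjunctive formulas $A, B$ and every truth value assignment $V$ with $V(B)=F$: $$(\Delta[V;A])^{A},\; (\Delta[V;B])^{\sim B} \vdash_{id} (\Delta[V;A \to B])^{\sim(A \to B)}.$$
   Context: **Language.** Formulas are built from the atomic formulas $p_1, p_2, \dots$ using the binary connectives $\to$, $\vee$ and $\&$. Implicative-disjunctive formulas are those without $\&$. Iterated connectives associate to the right. All formulas are arranged in a fixed decidable linear order $R$. **Semantics.** A truth value assignment $V$ maps formulas to $\{T,F\}$ according to the classical truth conditions. **Notation.** - $\Delta[V;A]$ is the set of atomic subformulas $C$ of $A$ with $V(C)=F$. - For a finite set $K$ of formulas with distinct elements $B_1, \dots, B_n$ listed in the order $R$: - $(K)^{A}$ is $A$ if $K$ is empty, and $B_1 \vee \dots \vee B_n \vee A$ otherwise; - $(K)^{\sim A}$ is $A$ if $K$ is empty, and $A \to (B_1 \vee \dots \vee B_n)$ otherwise. **Calculus.** $\vdash_{id}$ denotes derivability in the classical implicative-disjunctive propositional calculus. Its axiom schemes are: - $A \to B \to A$; - $(A \to B \to C) \to (A \to B) \to A \to C$; - $((A \to B) \to A) \to A$; - $A \to (A \vee B)$; - $A \to (B \vee A)$; - $(A \to C) \to (B \to C) \to (A \vee B) \to C$. Its only rule is modus ponens. -}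

module Defs where

open import Level using (0ℓ)
open import Data.Nat using (ℕ)
import Data.Nat as ℕ
open import Data.Bool using (Bool; true; false; not; _∧_; _∨_)
open import Data.List using (List; []; _∷_; _++_; foldr; filterᵇ; deduplicate)
open import Data.Product using (_×_; _,_; proj₁; proj₂)
open import Data.Empty using (⊥)
open import Data.List.Membership.Propositional using (_∈_)
open import Data.Unit using (⊤)
open import Relation.Nullary using (Dec; yes; no; ¬_)
open import Relation.Nullary.Decidable using (map′)
open import Relation.Binary using (Rel; IsDecTotalOrder)
open import Relation.Binary.Bundles using (DecTotalOrder)
open import Relation.Binary.PropositionalEquality using (_≡_; refl; cong; cong₂)
import Data.List.Sort.InsertionSort.Base as InsSort

-- Formulas: atoms p_1, p_2, ... (p (n) stands for p_{n+1}), and the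
-- binary connectives →, ∨, &.

infixr 6 _&_
infixr 5 _∨′_
infixr 4 _⇒_

data Formula : Set where
  p    : ℕ → Formula
  _⇒_  : Formula → Formula → Formula
  _∨′_ : Formula → Formula → Formula
  _&_  : Formula → Formula → Formula

ImpDisj : Formula → Set
ImpDisj (p n)   = ⊤
ImpDisj (A ⇒ B) = ImpDisj A × ImpDisj B
ImpDisj (A ∨′ B) = ImpDisj A × ImpDisj B
ImpDisj (A & B) = ⊥

private
  p-inj : ∀ {m n} → p m ≡ p n → m ≡ n
  p-inj refl = refl
  ⇒-inj : ∀ {A B C D} → (A ⇒ B) ≡ (C ⇒ D) → (A ≡ C) × (B ≡ D)
  ⇒-inj refl = refl , refl
  ∨-inj : ∀ {A B C D} → (A ∨′ B) ≡ (C ∨′ D) → (A ≡ C) × (B ≡ D)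
  ∨-inj refl = refl , refl
  &-inj : ∀ {A B C D} → (A & B) ≡ (C & D) → (A ≡ C) × (B ≡ D)
  &-inj refl = refl , refl

_≟F_ : (A B : Formula) → Dec (A ≡ B)
p m ≟F p n = map′ (cong p) p-inj (m ℕ.≟ n)
(A ⇒ B) ≟F (C ⇒ D) with A ≟F C | B ≟F D
... | yes refl | yes refl = yes refl
... | no ne | _ = no λ e → ne (proj₁ (⇒-inj e))
... | _ | no ne = no λ e → ne (proj₂ (⇒-inj e))
(A ∨′ B) ≟F (C ∨′ D) with A ≟F C | B ≟F D
... | yes refl | yes refl = yes refl
... | no ne | _ = no λ e → ne (proj₁ (∨-inj e))
... | _ | no ne = no λ e → ne (proj₂ (∨-inj e))
(A & B) ≟F (C & D) with A ≟F C | B ≟F D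
... | yes refl | yes refl = yes refl
... | no ne | _ = no λ e → ne (proj₁ (&-inj e))
... | _ | no ne = no λ e → ne (proj₂ (&-inj e))
p _ ≟F (_ ⇒ _) = no λ ()
p _ ≟F (_ ∨′ _) = no λ ()
p _ ≟F (_ & _) = no λ ()
(_ ⇒ _) ≟F p _ = no λ ()
(_ ⇒ _) ≟F (_ ∨′ _) = no λ ()
(_ ⇒ _) ≟F (_ & _) = no λ ()
(_ ∨′ _) ≟F p _ = no λ ()
(_ ∨′ _) ≟F (_ ⇒ _) = no λ ()
(_ ∨′ _) ≟F (_ & _) = no λ ()
(_ & _) ≟F p _ = no λ ()
(_ & _) ≟F (_ ⇒ _) = no λ ()
(_ & _) ≟F (_ ∨′ _) = no λ ()

Assignment : Set
Assignment = ℕ → Bool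

⟦_⟧_ : Formula → Assignment → Bool
⟦ p n ⟧ v    = v n
⟦ A ⇒ B ⟧ v  = not (⟦ A ⟧ v) ∨ ⟦ B ⟧ v
⟦ A ∨′ B ⟧ v = ⟦ A ⟧ v ∨ ⟦ B ⟧ v
⟦ A & B ⟧ v  = ⟦ A ⟧ v ∧ ⟦ B ⟧ v

atoms : Formula → List Formula
atoms (p n)    = p n ∷ []
atoms (A ⇒ B)  = atoms A ++ atoms B
atoms (A ∨′ B) = atoms A ++ atoms B
atoms (A & B)  = atoms A ++ atoms B

isFalse : Assignment → Formula → Bool
isFalse v C = not (⟦ C ⟧ v)

Δ : Assignment → Formula → List Formula
Δ v A = deduplicate _≟F_ (filterᵇ (isFalse v) (atoms A))

module WithOrder (_≤R_ : Rel Formula 0ℓ)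
                 (isDTO : IsDecTotalOrder _≡_ _≤R_) where

  R : DecTotalOrder 0ℓ 0ℓ 0ℓ
  R = record { Carrier = Formula ; _≈_ = _≡_ ; _≤_ = _≤R_
             ; isDecTotalOrder = isDTO }

  sortR : List Formula → List Formula
  sortR = InsSort.sort R

  bigOr : Formula → List Formula → Formula
  bigOr B []       = B
  bigOr B (C ∷ Cs) = B ∨′ bigOr C Cs

  plusSup : List Formula → Formula → Formula
  plusSup K A = foldr _∨′_ A (sortR K)

  negSup : List Formula → Formula → Formula
  negSup K A with sortR K
  ... | []     = A
  ... | B ∷ Bs = A ⇒ bigOr B Bs

infix 2 _⊢id_

data _⊢id_ (Γ : List Formula) : Formula → Set where
  hyp : ∀ {A} → A ∈ Γ → Γ ⊢id A
  ax1 : ∀ {A B} → ImpDisj A → ImpDisj B → Γ ⊢id A ⇒ B ⇒ A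
  ax2 : ∀ {A B C} → ImpDisj A → ImpDisj B → ImpDisj C →
        Γ ⊢id (A ⇒ B ⇒ C) ⇒ (A ⇒ B) ⇒ A ⇒ C
  ax3 : ∀ {A B} → ImpDisj A → ImpDisj B → Γ ⊢id ((A ⇒ B) ⇒ A) ⇒ A
  ax4 : ∀ {A B} → ImpDisj A → ImpDisj B → Γ ⊢id A ⇒ (A ∨′ B)
  ax5 : ∀ {A B} → ImpDisj A → ImpDisj B → Γ ⊢id A ⇒ (B ∨′ A)
  ax6 : ∀ {A B C} → ImpDisj A → ImpDisj B → ImpDisj C →
        Γ ⊢id (A ⇒ C) ⇒ (B ⇒ C) ⇒ (A ∨′ B) ⇒ C
  mp  : ∀ {A B} → Γ ⊢id A ⇒ B → Γ ⊢id A → Γ ⊢id B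

module Submission where

-- Assume A → B and split the hypothesis (Δ[V;A])^A into its disjuncts. An atom of Δ[V;A] is
-- itself a disjunct of the target disjunction over Δ[V;A → B]; and A gives B, hence by the
-- second hypothesis the disjunction over Δ[V;B], each atom of which again lies in Δ[V;A → B].
-- V(B) = F serves only to make Δ[V;B], and hence Δ[V;A → B], nonempty, so that both (·)^∼
-- formulas are genuine implications into disjunctions.

open import Defs
open import Level using (0ℓ)
open import Data.Bool using (true; false; not; T; T?)
open import Data.Bool.Properties using (∨-conicalˡ; ∨-conicalʳ)
open import Data.List using (List; []; _∷_; foldr)
open import Data.List.Relation.Unary.All using (All; []; _∷_; lookup)
open import Data.List.Relation.Unary.All.Properties using (++⁺; anti-mono)
open import Data.List.Relation.Unary.Any using (here; there)
open import Data.List.Membership.Propositional using (_∈_)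
open import Data.List.Membership.Propositional.Properties
  using (∈-filter⁺; ∈-deduplicate⁺; ∈-deduplicate⁻)
open import Data.List.Relation.Binary.Subset.Propositional using (_⊆_)
open import Data.List.Relation.Binary.Subset.Propositional.Properties
  using (⊆-reflexive-↭; filter⁺′; filter-⊆; xs⊆xs++ys; xs⊆ys++xs)
open import Data.List.Relation.Binary.Permutation.Propositional using (↭-sym)
import Data.List.Sort.InsertionSort.Properties as InsertionSort
open import Data.Product using (∃-syntax; _,_; proj₂; map₂)
open import Data.Unit using (tt)
open import Function using (id; _∘_)
open import Relation.Binary using (Rel; IsDecTotalOrder)
open import Relation.Binary.PropositionalEquality using (_≡_; refl; sym; subst; subst₂)

⊢-ImpDisj : ∀ {Γ Y} → All ImpDisj Γ → Γ ⊢id Y → ImpDisj Y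
⊢-ImpDisj wfΓ (hyp Y∈Γ)   = lookup wfΓ Y∈Γ
⊢-ImpDisj wfΓ (ax1 a b)   = a , b , a
⊢-ImpDisj wfΓ (ax2 a b c) = (a , b , c) , (a , b) , a , c
⊢-ImpDisj wfΓ (ax3 a b)   = ((a , b) , a) , a
⊢-ImpDisj wfΓ (ax4 a b)   = a , a , b
⊢-ImpDisj wfΓ (ax5 a b)   = a , b , a
⊢-ImpDisj wfΓ (ax6 a b c) = (a , c) , (b , c) , (a , b) , c
⊢-ImpDisj wfΓ (mp d e)    = proj₂ (⊢-ImpDisj wfΓ d)

foldr-∨-ImpDisj : ∀ {A L} → All ImpDisj L → ImpDisj A → ImpDisj (foldr _∨′_ A L)
foldr-∨-ImpDisj []         a = a
foldr-∨-ImpDisj (x ∷ wfL) a = x , foldr-∨-ImpDisj wfL a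

module DerivedRules {Γ : List Formula} (wfΓ : All ImpDisj Γ) where

  ⇒-refl : ∀ {X} → ImpDisj X → Γ ⊢id X ⇒ X
  ⇒-refl x = mp (mp (ax2 x (x , x) x) (ax1 x (x , x))) (ax1 x x)

  ⇒-const : ∀ {X Y} → ImpDisj X → Γ ⊢id Y → Γ ⊢id X ⇒ Y
  ⇒-const x d = mp (ax1 (⊢-ImpDisj wfΓ d) x) d

  ⇒-trans : ∀ {X Y Z} → Γ ⊢id X ⇒ Y → Γ ⊢id Y ⇒ Z → Γ ⊢id X ⇒ Z
  ⇒-trans X⇒Y Y⇒Z with ⊢-ImpDisj wfΓ X⇒Y | ⊢-ImpDisj wfΓ Y⇒Z
  ... | x , y | _ , z = mp (mp (ax2 x y z) (⇒-const x Y⇒Z)) X⇒Y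

  ∨-elim : ∀ {X Y Z} → Γ ⊢id X ⇒ Z → Γ ⊢id Y ⇒ Z → Γ ⊢id X ∨′ Y ⇒ Z
  ∨-elim X⇒Z Y⇒Z with ⊢-ImpDisj wfΓ X⇒Z | ⊢-ImpDisj wfΓ Y⇒Z
  ... | x , z | y , _ = mp (mp (ax6 x y z) X⇒Z) Y⇒Z

  foldr-∨-elim : ∀ {A G} L → (∀ {x} → x ∈ L → Γ ⊢id x ⇒ G) → Γ ⊢id A ⇒ G →
                 Γ ⊢id foldr _∨′_ A L ⇒ G
  foldr-∨-elim []      L⇒G A⇒G = A⇒G
  foldr-∨-elim (_ ∷ L) L⇒G A⇒G = ∨-elim (L⇒G (here refl)) (foldr-∨-elim L (L⇒G ∘ there) A⇒G)

  deduction : ∀ {X Y} → ImpDisj X → X ∷ Γ ⊢id Y → Γ ⊢id X ⇒ Y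
  deduction x (hyp (here refl))  = ⇒-refl x
  deduction x (hyp (there Y∈Γ)) = ⇒-const x (hyp Y∈Γ)
  deduction x (ax1 a b)          = ⇒-const x (ax1 a b)
  deduction x (ax2 a b c)        = ⇒-const x (ax2 a b c)
  deduction x (ax3 a b)          = ⇒-const x (ax3 a b)
  deduction x (ax4 a b)          = ⇒-const x (ax4 a b)
  deduction x (ax5 a b)          = ⇒-const x (ax5 a b)
  deduction x (ax6 a b c)        = ⇒-const x (ax6 a b c)
  deduction x (mp d e) with ⊢-ImpDisj (x ∷ wfΓ) d
  ... | y′ , y = mp (mp (ax2 x y′ y) (deduction x d)) (deduction x e)

atoms-ImpDisj : ∀ X → All ImpDisj (atoms X)
atoms-ImpDisj (p n)    = tt ∷ []
atoms-ImpDisj (X ⇒ Y)  = ++⁺ (atoms-ImpDisj X) (atoms-ImpDisj Y)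
atoms-ImpDisj (X ∨′ Y) = ++⁺ (atoms-ImpDisj X) (atoms-ImpDisj Y)
atoms-ImpDisj (X & Y)  = ++⁺ (atoms-ImpDisj X) (atoms-ImpDisj Y)

module _ (V : Assignment) where

  Δ-⊆-atoms : ∀ X → Δ V X ⊆ atoms X
  Δ-⊆-atoms X = filter-⊆ (T? ∘ isFalse V) (atoms X) ∘ ∈-deduplicate⁻ _≟F_ _

  Δ-mono : ∀ {X Y} → atoms X ⊆ atoms Y → Δ V X ⊆ Δ V Y
  Δ-mono X⊆Y = ∈-deduplicate⁺ _≟F_ ∘ filter⁺′ P? P? id X⊆Y ∘ ∈-deduplicate⁻ _≟F_ _
    where P? = T? ∘ isFalse V

  Δ-nonempty : ∀ X → ⟦ X ⟧ V ≡ false → ∃[ x ] x ∈ Δ V X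
  Δ-nonempty (p n) Vn≡false =
    p n , ∈-deduplicate⁺ _≟F_ (∈-filter⁺ (T? ∘ isFalse V) (here refl) (subst (T ∘ not) (sym Vn≡false) tt))
  Δ-nonempty (X ⇒ Y) X⇒Y≡false =
    map₂ (Δ-mono {Y} {X ⇒ Y} (xs⊆ys++xs _ _)) (Δ-nonempty Y (∨-conicalʳ _ _ X⇒Y≡false))
  Δ-nonempty (X ∨′ Y) X∨Y≡false =
    map₂ (Δ-mono {X} {X ∨′ Y} (xs⊆xs++ys _ _)) (Δ-nonempty X (∨-conicalˡ _ _ X∨Y≡false))
  Δ-nonempty (X & Y) X&Y≡false with ⟦ X ⟧ V in X≡
  ... | false = map₂ (Δ-mono {X} {X & Y} (xs⊆xs++ys _ _)) (Δ-nonempty X X≡)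
  ... | true  = map₂ (Δ-mono {Y} {X & Y} (xs⊆ys++xs _ _)) (Δ-nonempty Y X&Y≡false)

module Sorted (_≤R_ : Rel Formula 0ℓ) (isDTO : IsDecTotalOrder _≡_ _≤R_) where
  open WithOrder _≤R_ isDTO

  sortR-⊆ : ∀ K → sortR K ⊆ K
  sortR-⊆ K = ⊆-reflexive-↭ (InsertionSort.sort-↭ R K)

  ⊆-sortR : ∀ K → K ⊆ sortR K
  ⊆-sortR K = ⊆-reflexive-↭ (↭-sym (InsertionSort.sort-↭ R K))

  sortR-mono : ∀ {K M} → K ⊆ M → sortR K ⊆ sortR M
  sortR-mono {K} {M} K⊆M = ⊆-sortR M ∘ K⊆M ∘ sortR-⊆ K

  bigOr-ImpDisj : ∀ {C Cs} → All ImpDisj (C ∷ Cs) → ImpDisj (bigOr C Cs)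
  bigOr-ImpDisj (c ∷ [])          = c
  bigOr-ImpDisj (c ∷ cs@(_ ∷ _)) = c , bigOr-ImpDisj cs

  module _ {Γ : List Formula} (wfΓ : All ImpDisj Γ) where
    open DerivedRules wfΓ

    bigOr-intro : ∀ {C Cs x} → All ImpDisj (C ∷ Cs) → x ∈ C ∷ Cs → Γ ⊢id x ⇒ bigOr C Cs
    bigOr-intro (c ∷ [])          (here refl) = ⇒-refl c
    bigOr-intro (c ∷ cs@(_ ∷ _)) (here refl) = ax4 c (bigOr-ImpDisj cs)
    bigOr-intro (c ∷ cs@(_ ∷ _)) (there x∈Cs) =
      ⇒-trans (bigOr-intro cs x∈Cs) (ax5 (bigOr-ImpDisj cs) c)

    bigOr-elim : ∀ {C G} Cs → (∀ {x} → x ∈ C ∷ Cs → Γ ⊢id x ⇒ G) → Γ ⊢id bigOr C Cs ⇒ G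
    bigOr-elim []       Cs⇒G = Cs⇒G (here refl)
    bigOr-elim (_ ∷ Cs) Cs⇒G = ∨-elim (Cs⇒G (here refl)) (bigOr-elim Cs (Cs⇒G ∘ there))

    bigOr-⊆ : ∀ {C Cs D Ds} → All ImpDisj (D ∷ Ds) → C ∷ Cs ⊆ D ∷ Ds →
              Γ ⊢id bigOr C Cs ⇒ bigOr D Ds
    bigOr-⊆ {Cs = Cs} wfD C⊆D = bigOr-elim Cs (bigOr-intro wfD ∘ C⊆D)

  implication-by-cases : ∀ {A B L E Es F Fs} → ImpDisj A → ImpDisj B → All ImpDisj (F ∷ Fs) →
    L ⊆ F ∷ Fs → E ∷ Es ⊆ F ∷ Fs →
    foldr _∨′_ A L ∷ (B ⇒ bigOr E Es) ∷ [] ⊢id (A ⇒ B) ⇒ bigOr F Fs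
  implication-by-cases {A} {B} {L} {E} {Es} {F} {Fs} a b wfF L⊆F E⊆F =
    deduction (a , b) (mp (foldr-∨-elim L L⇒F A⇒F) (hyp (there (here refl))))
    where
    Γ : List Formula
    Γ = foldr _∨′_ A L ∷ (B ⇒ bigOr E Es) ∷ []

    wfΓ : All ImpDisj Γ
    wfΓ = foldr-∨-ImpDisj (anti-mono L⊆F wfF) a ∷ (b , bigOr-ImpDisj (anti-mono E⊆F wfF)) ∷ []

    wfΓ′ : All ImpDisj ((A ⇒ B) ∷ Γ)
    wfΓ′ = (a , b) ∷ wfΓ

    open DerivedRules wfΓ using (deduction)
    open DerivedRules wfΓ′ using (⇒-trans; foldr-∨-elim)

    L⇒F : ∀ {x} → x ∈ L → (A ⇒ B) ∷ Γ ⊢id x ⇒ bigOr F Fs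
    L⇒F = bigOr-intro wfΓ′ wfF ∘ L⊆F

    A⇒F : (A ⇒ B) ∷ Γ ⊢id A ⇒ bigOr F Fs
    A⇒F = ⇒-trans (⇒-trans (hyp (here refl)) (hyp (there (there (here refl))))) (bigOr-⊆ wfΓ′ wfF E⊆F)

  plusSup-negSup-⇒ : ∀ {A B L K M x} → ImpDisj A → ImpDisj B → All ImpDisj M →
    x ∈ K → L ⊆ M → K ⊆ M → plusSup L A ∷ negSup K B ∷ [] ⊢id negSup M (A ⇒ B)
  plusSup-negSup-⇒ {A} {B} {L} {K} {M} a b wfM x∈K L⊆M K⊆M with sortR K in K≡ | sortR M in M≡
  ... | [] | _ with () ← subst (_ ∈_) K≡ (⊆-sortR K x∈K)
  ... | _ ∷ _ | [] with () ← subst (_ ∈_) M≡ (⊆-sortR M (K⊆M x∈K))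
  ... | E ∷ Es | F ∷ Fs = implication-by-cases a b
    (subst (All ImpDisj) M≡ (anti-mono (sortR-⊆ M) wfM))
    (subst (sortR L ⊆_) M≡ (sortR-mono L⊆M))
    (subst₂ _⊆_ K≡ M≡ (sortR-mono K⊆M))

mainTheorem14 : (_≤R_ : Rel Formula 0ℓ) (isDTO : IsDecTotalOrder _≡_ _≤R_) →
    (A B : Formula) → ImpDisj A → ImpDisj B → (V : Assignment) → ⟦ B ⟧ V ≡ false →
    (WithOrder.plusSup _≤R_ isDTO (Δ V A) A ∷ WithOrder.negSup _≤R_ isDTO (Δ V B) B ∷ [])
      ⊢id WithOrder.negSup _≤R_ isDTO (Δ V (A ⇒ B)) (A ⇒ B)
mainTheorem14 _≤R_ isDTO A B a b V B≡false =
  plusSup-negSup-⇒ a b (anti-mono (Δ-⊆-atoms V (A ⇒ B)) (atoms-ImpDisj (A ⇒ B)))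
    (proj₂ (Δ-nonempty V B B≡false))
    (Δ-mono V {A} {A ⇒ B} (xs⊆xs++ys _ _))
    (Δ-mono V {B} {A ⇒ B} (xs⊆ys++xs _ _))
  where open Sorted _≤R_ isDTO
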